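{- For any tree $T$ of order $n\geq 3$, $\chi_d^t(T)\geq s+1$, where $s$ is the number of support vertices of $T$.
   Context: In a tree, a leaf is a vertex of degree one, and a support vertex is a neighbor of a leaf that has degree more than one. A total dominator coloring of a graph $G$ is a proper vertex coloring of $G$ in which each vertex of $G$ is adjacent to every vertex of some color class; $\chi_d^t(G)$ is the minimum number of color classes in a total dominator coloring of $G$. -}

module Defs where

open import Data.Nat using (ℕ; zero; suc; _≤_; _<_; _≡ᵇ_; _<ᵇ_)
open import Data.Fin using (Fin)
open import Data.Bool using (Bool; true; false; if_then_else_; _∧_)
open import Data.List using (List; []; _∷_; _++_; [_]; length; allFin; map)
open import Data.Nat.ListAction using (sum)
open import Data.Bool.ListAction using (any)
open import Data.List.Relation.Unary.Unique.Propositional using (Unique)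
open import Data.Product using (Σ; ∃; _×_)
open import Data.Empty using (⊥)
open import Relation.Nullary using (¬_)
open import Relation.Binary.PropositionalEquality using (_≡_; _≢_)
open import Function using (Surjective)

record Graph (n : ℕ) : Set where
  field
    adj   : Fin n → Fin n → Bool
    sym   : ∀ u v → adj u v ≡ adj v u
    irref : ∀ v → adj v v ≡ false
open Graph public

module _ {n : ℕ} (G : Graph n) where

  Adj : Fin n → Fin n → Set
  Adj u v = adj G u v ≡ true

  data Walk : Fin n → Fin n → Set where
    here : ∀ {v} → Walk v v
    step : ∀ {u w v} → Adj u w → Walk w v → Walk u v

  Connected : Set
  Connected = ∀ u v → Walk u v

  Chain : List (Fin n) → Set
  Chain []            = Data.Unit.⊤
    where import Data.Unit
  Chain (x ∷ [])      = Data.Unit.⊤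
    where import Data.Unit
  Chain (x ∷ y ∷ zs)  = Adj x y × Chain (y ∷ zs)

  -- a cycle x, v₁, …, vₘ (m ≥ 2, i.e. at least 3 vertices), all distinct,
  -- consecutive ones adjacent and vₘ adjacent to x
  IsCycle : Fin n → List (Fin n) → Set
  IsCycle x vs = (2 ≤ length vs) × Unique (x ∷ vs) × Chain (x ∷ vs ++ [ x ])

  Acyclic : Set
  Acyclic = ∀ x vs → ¬ IsCycle x vs

  IsTree : Set
  IsTree = Connected × Acyclic

  degree : Fin n → ℕ
  degree v = sum (map (λ u → if adj G v u then 1 else 0) (allFin n))

  isLeaf : Fin n → Bool
  isLeaf v = degree v ≡ᵇ 1

  isSupport : Fin n → Bool
  isSupport v = (1 <ᵇ degree v) ∧ any (λ u → adj G v u ∧ isLeaf u) (allFin n)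

  numSupport : ℕ
  numSupport = sum (map (λ v → if isSupport v then 1 else 0) (allFin n))

  IsProperColoring : (k : ℕ) → (Fin n → Fin k) → Set
  IsProperColoring k c = ∀ u v → Adj u v → c u ≢ c v

  -- total dominator colouring with exactly k colour classes:
  -- c is proper, surjective (so the k classes are nonempty), and every
  -- vertex is adjacent to every vertex of some colour class
  IsTDC : (k : ℕ) → (Fin n → Fin k) → Set
  IsTDC k c = IsProperColoring k c
            × Surjective _≡_ _≡_ c
            × (∀ v → ∃ λ (i : Fin k) → ∀ u → c u ≡ i → Adj v u)

-- A leaf ℓ is adjacent to nothing but its support vertex s, so the colour class
-- that ℓ dominates can only be {s}: every support vertex forms a colour class of
-- its own. A vertex that is not a support vertex (a leaf, or any vertex if there
-- are no support vertices) then needs one further colour.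
module Submission where

open import Defs hiding (sym)
open import Data.Nat using (ℕ; suc; _≤_; _<_)
open import Data.Nat.Properties using (≡ᵇ⇒≡; <ᵇ⇒<; <-irrefl)
open import Data.Fin using (Fin; zero; suc)
open import Data.Fin.Properties using (injective⇒≤)
open import Data.Bool using (Bool; true; false; if_then_else_; T)
open import Data.Bool.Properties using (T-∧; T-≡)
open import Data.List using (List; []; _∷_; length; allFin; filter; lookup; map)
open import Data.Nat.ListAction using (sum)
open import Data.List.Membership.Propositional using (_∈_)
open import Data.List.Membership.Propositional.Properties
  using (∈-allFin; ∈-filter⁺; ∈-filter⁻; ∈-lookup)
open import Data.List.Relation.Unary.Any using (here; there; satisfied)
open import Data.List.Relation.Unary.Any.Properties using (any⁻)
import Data.List.Relation.Unary.All as All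
open import Data.List.Relation.Unary.AllPairs using (_∷_)
open import Data.List.Relation.Unary.Unique.Propositional using (Unique)
open import Data.List.Relation.Unary.Unique.Propositional.Properties using (filter⁺; allFin⁺)
open import Data.Product using (∃; _×_; _,_; proj₁; proj₂)
open import Data.Empty using (⊥-elim)
open import Function using (_∘_; Injective; Equivalence)
open import Relation.Nullary using (¬_; yes; no)
open import Relation.Nullary.Decidable using (T?)
open import Relation.Binary.PropositionalEquality
  using (_≡_; refl; sym; trans; cong; subst)

sum-indicator≡length-filter : ∀ {A : Set} (f : A → Bool) (xs : List A) →
  sum (map (λ x → if f x then 1 else 0) xs) ≡ length (filter (T? ∘ f) xs)
sum-indicator≡length-filter f [] = refl
sum-indicator≡length-filter f (x ∷ xs) with f x
... | true  = cong suc (sum-indicator≡length-filter f xs)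
... | false = sum-indicator≡length-filter f xs

length≡1⇒∈-unique : ∀ {A : Set} {xs : List A} {x y : A} →
                    length xs ≡ 1 → x ∈ xs → y ∈ xs → x ≡ y
length≡1⇒∈-unique {xs = _ ∷ []} refl (here refl) (here refl) = refl

lookup-injective : ∀ {A : Set} {xs : List A} → Unique xs →
                   Injective _≡_ _≡_ (lookup xs)
lookup-injective (_ ∷ _)    {zero}  {zero}  _  = refl
lookup-injective (x∉ ∷ _)   {zero}  {suc j} eq = ⊥-elim (All.lookup x∉ (∈-lookup j) eq)
lookup-injective (x∉ ∷ _)   {suc i} {zero}  eq = ⊥-elim (All.lookup x∉ (∈-lookup i) (sym eq))
lookup-injective (_ ∷ uniq) {suc i} {suc j} eq = cong suc (lookup-injective uniq eq)

injectiveOn-unique⇒length≤ : ∀ {A : Set} {k} {xs : List A} (c : A → Fin k) → Unique xs →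
  (∀ {x y} → x ∈ xs → y ∈ xs → c x ≡ c y → x ≡ y) → length xs ≤ k
injectiveOn-unique⇒length≤ c uniq injOn =
  injective⇒≤ (lookup-injective uniq ∘ injOn (∈-lookup _) (∈-lookup _))

module _ {n : ℕ} (G : Graph n) where

  Adj-sym : ∀ {u v} → Adj G u v → Adj G v u
  Adj-sym {u} {v} = trans (Graph.sym G v u)

  neighbours : Fin n → List (Fin n)
  neighbours v = filter (T? ∘ adj G v) (allFin n)

  degree≡length-neighbours : ∀ v → degree G v ≡ length (neighbours v)
  degree≡length-neighbours v = sum-indicator≡length-filter (adj G v) (allFin n)

  ∈-neighbours : ∀ {v u} → Adj G v u → u ∈ neighbours v
  ∈-neighbours {v} {u} vu = ∈-filter⁺ (T? ∘ adj G v) (∈-allFin u) (Equivalence.from T-≡ vu)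

  leaf-neighbour-unique : ∀ {l u w} → T (isLeaf G l) → Adj G l u → Adj G l w → u ≡ w
  leaf-neighbour-unique {l} {u} {w} leaf lu lw = length≡1⇒∈-unique
    (trans (sym (degree≡length-neighbours l)) (≡ᵇ⇒≡ (degree G l) 1 leaf))
    (∈-neighbours lu) (∈-neighbours lw)

  support⇒leaf-neighbour : ∀ {s} → T (isSupport G s) → ∃ λ l → Adj G s l × T (isLeaf G l)
  support⇒leaf-neighbour supp
    with l , sl∧leaf ← satisfied (any⁻ _ (allFin n) (proj₂ (Equivalence.to T-∧ supp)))
    with sl , leaf ← Equivalence.to T-∧ sl∧leaf
    = l , Equivalence.to T-≡ sl , leaf

  leaf⇒¬support : ∀ {l} → T (isLeaf G l) → ¬ T (isSupport G l)
  leaf⇒¬support {l} leaf supp = <-irrefl refl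
    (subst (1 <_) (≡ᵇ⇒≡ (degree G l) 1 leaf)
           (<ᵇ⇒< 1 (degree G l) (proj₁ (Equivalence.to T-∧ supp))))

  non-support-vertex : Fin n → ∃ λ w → ¬ T (isSupport G w)
  non-support-vertex v with T? (isSupport G v)
  ... | no ¬supp = v , ¬supp
  ... | yes supp with l , _ , leaf ← support⇒leaf-neighbour supp
    = l , leaf⇒¬support leaf

  supports : List (Fin n)
  supports = filter (T? ∘ isSupport G) (allFin n)

  numSupport≡length-supports : numSupport G ≡ length supports
  numSupport≡length-supports = sum-indicator≡length-filter (isSupport G) (allFin n)

  module _ {k : ℕ} {c : Fin n → Fin k} (tdc : IsTDC G k c) where

    support-colour-class-singleton : ∀ {s x} → T (isSupport G s) → c x ≡ c s → x ≡ s
    support-colour-class-singleton supp cx≡cs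
      with l , sl , leaf ← support⇒leaf-neighbour supp
      with i , l↝i ← proj₂ (proj₂ tdc) l
      with v , cv≡i ← proj₁ (proj₂ tdc) i
      = leaf-neighbour-unique leaf (l↝i _ (trans cx≡cs cs≡i)) (Adj-sym sl)
      where
      cs≡i : c _ ≡ i
      cs≡i = subst (λ w → c w ≡ i)
                   (leaf-neighbour-unique leaf (l↝i v (cv≡i refl)) (Adj-sym sl))
                   (cv≡i refl)

    numSupport<colours : ∀ {w} → ¬ T (isSupport G w) → suc (numSupport G) ≤ k
    numSupport<colours {w} ¬supp =
      subst (λ m → suc m ≤ k) (sym numSupport≡length-supports)
            (injectiveOn-unique⇒length≤ c uniq injOn)
      where
      isSupport-∈ : ∀ {x} → x ∈ supports → T (isSupport G x)
      isSupport-∈ = proj₂ ∘ ∈-filter⁻ (T? ∘ isSupport G) {xs = allFin n}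

      uniq : Unique (w ∷ supports)
      uniq = All.tabulate (λ x∈ w≡x → ¬supp (subst (T ∘ isSupport G) (sym w≡x) (isSupport-∈ x∈)))
           ∷ filter⁺ (T? ∘ isSupport G) (allFin⁺ n)

      injOn : ∀ {x y} → x ∈ w ∷ supports → y ∈ w ∷ supports → c x ≡ c y → x ≡ y
      injOn _           (there y∈) eq = support-colour-class-singleton (isSupport-∈ y∈) eq
      injOn (there x∈)  (here refl) eq = sym (support-colour-class-singleton (isSupport-∈ x∈) (sym eq))
      injOn (here refl) (here refl) _  = refl

lemma6p2 : (n : ℕ) (T : Graph n) → IsTree T → 3 ≤ n →
           (k : ℕ) (c : Fin n → Fin k) → IsTDC T k c →
           suc (numSupport T) ≤ k
lemma6p2 (suc n) T _ _ k c tdc = numSupport<colours T tdc (proj₂ (non-support-vertex T zero))
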